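{- Let $m \ge 1$ and $n \ge 1$ be integers and let $A = \{0,1,\ldots,m-1\}$. Let $P(X_1,\ldots,X_n) \in \mathbb{R}[X_1,\ldots,X_n]$ be a polynomial that weakly sign represents the parity function over $A^n$, and suppose that the degree of $P$ in each variable $X_i$ is at most $m-1$. Then the sparsity of $P$ is at least $(m-1)^n$.
   Context: For $A \subseteq \mathbb{Z}$, the parity function $\mathrm{Par}: A^n \to \{0,1\}$ is $\mathrm{Par}(a_1,\ldots,a_n) = \sum_{i=1}^n a_i \bmod 2$. A polynomial $P \in \mathbb{R}[X_1,\ldots,X_n]$ weakly sign represents $f: A^n \to \{0,1\}$ if for every $a \in A^n$: $f(a) = 0 \Rightarrow P(a) \ge 0$ and $f(a) = 1 \Rightarrow P(a) \le 0$, and moreover $P$ does not vanish identically on $A^n$ (i.e. $P(a) \neq 0$ for some $a \in A^n$). The sparsity of $P$ is the number of monomials with nonzero coefficient in the standard monomial basis. The degree of $P$ in $X_i$ is the largest exponent of $X_i$ among monomials with nonzero coefficient. -}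

module Defs where

open import Level using (Level; _⊔_) renaming (suc to lsuc)
open import Algebra.Bundles using (CommutativeRing)
open import Relation.Binary.Core using (Rel)
open import Relation.Binary.Structures using (IsTotalOrder)
open import Relation.Nullary using (¬_)
open import Data.Product using (∃; _×_)
open import Data.Nat using (ℕ; zero; suc; _%_)
open import Data.Fin using (Fin; toℕ)
open import Data.Vec using (Vec; []; _∷_)
import Data.Nat as ℕ

record OrderedField c ℓ₁ ℓ₂ : Set (lsuc (c ⊔ ℓ₁ ⊔ ℓ₂)) where
  field
    commutativeRing : CommutativeRing c ℓ₁
  open CommutativeRing commutativeRing public
  field
    _≤_          : Rel Carrier ℓ₂
    isTotalOrder : IsTotalOrder _≈_ _≤_
    +-mono-≤     : ∀ z {x y} → x ≤ y → (x + z) ≤ (y + z)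
    *-nonneg     : ∀ {x y} → 0# ≤ x → 0# ≤ y → 0# ≤ (x * y)
    0≉1          : ¬ (0# ≈ 1#)
    inverse      : ∀ x → ¬ (x ≈ 0#) → ∃ λ y → (x * y) ≈ 1#

module Poly {c ℓ₁ ℓ₂} (F : OrderedField c ℓ₁ ℓ₂) where
  open OrderedField F

  fromℕ : ℕ → Carrier
  fromℕ zero    = 0#
  fromℕ (suc k) = 1# + fromℕ k

  pow : Carrier → ℕ → Carrier
  pow x zero    = 1#
  pow x (suc k) = x * pow x k

  sumFin : ∀ k → (Fin k → Carrier) → Carrier
  sumFin zero    f = 0#
  sumFin (suc k) f = f Fin.zero + sumFin k (λ j → f (Fin.suc j))
    where import Data.Fin as Fin

  sumVec : ∀ m n → (Vec (Fin m) n → Carrier) → Carrier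
  sumVec m zero    f = f []
  sumVec m (suc n) f = sumFin m (λ j → sumVec m n (λ e → f (j ∷ e)))

  -- A polynomial in X_1..X_n whose degree in each variable is ≤ m-1 is
  -- given by its coefficient function on exponent vectors e ∈ {0..m-1}^n.
  Polynomial : ℕ → ℕ → Set c
  Polynomial m n = Vec (Fin m) n → Carrier

  monomial : ∀ {m n} → Vec (Fin m) n → Vec (Fin m) n → Carrier
  monomial []       []       = 1#
  monomial (e ∷ es) (a ∷ as) = pow (fromℕ (toℕ a)) (toℕ e) * monomial es as

  eval : ∀ {m n} → Polynomial m n → Vec (Fin m) n → Carrier
  eval {m} {n} P a = sumVec m n (λ e → P e * monomial e a)

  Par : ∀ {m n} → Vec (Fin m) n → ℕ
  Par a = Data.Vec.foldr _ (λ x s → toℕ x ℕ.+ s) 0 a % 2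
    where import Data.Vec

  WeaklySignRepresentsPar : ∀ {m n} → Polynomial m n → Set (ℓ₁ ⊔ ℓ₂)
  WeaklySignRepresentsPar {m} {n} P =
    ((a : Vec (Fin m) n) →
        (Par a ≡ 0 → 0# ≤ eval P a) × (Par a ≡ 1 → eval P a ≤ 0#))
    × (∃ λ (a : Vec (Fin m) n) → ¬ (eval P a ≈ 0#))
    where open import Relation.Binary.PropositionalEquality using (_≡_)

{-# OPTIONS --safe #-}
-- Write P(x, y) = Σⱼ Qⱼ(y) xʲ with x the first variable. For each fixed y, x ↦ P(x, y) has the
-- sign (-1)^(x + |y|) (weakly) at x = 0, …, m-1, and a univariate polynomial of degree < m with this
-- property has coefficients cₖ of sign (-1)^(k + |y|), nonzero for k ≥ 1 unless the polynomial
-- vanishes at all these points. Hence every Qₖ with k ≥ 1 again weakly sign-represents a shifted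
-- parity in the remaining variables and does not vanish at y₀, where P(x₀, y₀) ≠ 0. By induction
-- on n every coefficient whose exponents are all positive is nonzero; there are (m-1)ⁿ of them.
--
-- The univariate fact is read off Newton's forward differences. In the falling-factorial basis the
-- j-th coefficient of p is Δʲp(0)/j!, and Δ maps a weakly alternating sequence to a weakly
-- alternating one (nonzero somewhere if the sequence was), so these coefficients alternate and the
-- top one is nonzero. Returning to the monomial basis with the signed Stirling numbers of the first
-- kind, which alternate in sign and are nonzero for 1 ≤ k ≤ j, writes (-1)^(k + |y|) cₖ as a sum of
-- nonnegative terms whose last one is nonzero.
module Submission where

open import Algebra.Bundles using (CommutativeRing)
import Algebra.Properties.AbelianGroup as AbelianGroupProperties
import Algebra.Properties.CommutativeSemigroup as CommutativeSemigroupProperties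
import Algebra.Properties.Group as GroupProperties
import Algebra.Properties.Monoid.Mult.TCOptimised as MonoidMultiplication
import Algebra.Properties.Ring as RingProperties
import Algebra.Properties.Semiring.Mult.TCOptimised as SemiringMultiplication
import Algebra.Properties.Semiring.Sum as SemiringSum
import Algebra.Solver.Ring as RingSolver
open import Algebra.Solver.Ring.AlmostCommutativeRing
  using (fromCommutativeRing; _-Raw-AlmostCommutative⟶_; Induced-equivalence)
open import Data.Fin as Fin using (Fin; toℕ)
import Data.Fin.Properties as Fin
open import Data.Integer as ℤ using (ℤ; +_; -[1+_]; _⊖_)
import Data.Integer.Properties as ℤ
open import Data.Maybe using (just; nothing)
open import Data.Nat as ℕ using (ℕ; zero; suc; z≤n; s≤s; z<s; s<s; _%_; _∸_; _^_)
import Data.Nat.Properties as ℕ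
open import Data.Product using (∃; ∃-syntax; _×_; _,_; proj₁; proj₂)
open import Data.Sum using (_⊎_; inj₁; inj₂)
open import Data.Vec as Vec using (Vec; []; _∷_)
import Data.Vec.Properties as Vec
open import Data.Vec.Functional using (Vector)
open import Function using (_∘_)
open import Function.Definitions using (Injective)
open import Relation.Binary.Core using (Rel)
open import Relation.Binary.Definitions using (WeaklyDecidable)
open import Relation.Binary.PropositionalEquality as ≡ using (_≡_; _≗_)
open import Relation.Binary.Structures using (IsTotalOrder)
open import Relation.Nullary using (¬_; yes; no)

open import Defs

-- The ring solver only normalises when coefficient equality is decidable, hence coefficients in ℤ,
-- which maps into every commutative ring.
module IntegerRingSolver {c ℓ} (R : CommutativeRing c ℓ) where

  open CommutativeRing R
  open AbelianGroupProperties +-abelianGroup using (⁻¹-∙-comm)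
  open CommutativeSemigroupProperties +-commutativeSemigroup using (interchange)
  open GroupProperties +-group using (ε⁻¹≈ε; ⁻¹-involutive)
  open MonoidMultiplication +-monoid using (1+×; ×-homo-+) renaming (_×_ to _·_)
  open RingProperties ring using (-‿distribˡ-*; -‿distribʳ-*)
  open SemiringMultiplication semiring using (×1-homo-*)
  open import Relation.Binary.Reasoning.Setoid setoid

  fromℤ : ℤ → Carrier
  fromℤ (+ n)    = n · 1#
  fromℤ -[1+ n ] = - (suc n · 1#)

  fromℤ-⊖ : ∀ m n → fromℤ (m ⊖ n) ≈ m · 1# - n · 1#
  fromℤ-⊖ m zero = begin
    fromℤ (m ⊖ 0)  ≡⟨ ≡.cong fromℤ (ℤ.⊖-≥ {m} z≤n) ⟩
    m · 1#         ≈⟨ +-identityʳ _ ⟨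
    m · 1# + 0#    ≈⟨ +-congˡ ε⁻¹≈ε ⟨
    m · 1# - 0#    ∎
  fromℤ-⊖ zero (suc n) = begin
    fromℤ (0 ⊖ suc n)    ≡⟨ ≡.cong fromℤ (ℤ.⊖-< {0} {suc n} z<s) ⟩
    - (suc n · 1#)       ≈⟨ +-identityˡ _ ⟨
    0# - suc n · 1#      ∎
  fromℤ-⊖ (suc m) (suc n) = begin
    fromℤ (suc m ⊖ suc n)                ≡⟨ ≡.cong fromℤ (ℤ.[1+m]⊖[1+n]≡m⊖n m n) ⟩
    fromℤ (m ⊖ n)                        ≈⟨ fromℤ-⊖ m n ⟩
    m · 1# - n · 1#                      ≈⟨ +-identityˡ _ ⟨
    0# + (m · 1# - n · 1#)               ≈⟨ +-congʳ (-‿inverseʳ 1#) ⟨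
    (1# - 1#) + (m · 1# - n · 1#)        ≈⟨ interchange _ _ _ _ ⟩
    (1# + m · 1#) + (- 1# - n · 1#)      ≈⟨ +-congˡ (⁻¹-∙-comm _ _) ⟩
    (1# + m · 1#) - (1# + n · 1#)        ≈⟨ +-cong (1+× m 1#) (-‿cong (1+× n 1#)) ⟨
    suc m · 1# - suc n · 1#              ∎

  fromℤ-+ : ∀ i j → fromℤ (i ℤ.+ j) ≈ fromℤ i + fromℤ j
  fromℤ-+ (+ m)    (+ n)    = ×-homo-+ 1# m n
  fromℤ-+ (+ m)    -[1+ n ] = fromℤ-⊖ m (suc n)
  fromℤ-+ -[1+ m ] (+ n)    = trans (fromℤ-⊖ n (suc m)) (+-comm _ _)
  fromℤ-+ -[1+ m ] -[1+ n ] = begin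
    - (suc (suc (m ℕ.+ n)) · 1#)         ≡⟨ ≡.cong (λ k → - (suc k · 1#)) (ℕ.+-suc m n) ⟨
    - ((suc m ℕ.+ suc n) · 1#)           ≈⟨ -‿cong (×-homo-+ 1# (suc m) (suc n)) ⟩
    - (suc m · 1# + suc n · 1#)          ≈⟨ ⁻¹-∙-comm _ _ ⟨
    - (suc m · 1#) - suc n · 1#          ∎

  fromℤ-* : ∀ i j → fromℤ (i ℤ.* j) ≈ fromℤ i * fromℤ j
  fromℤ-* (+ zero)  j         = sym (zeroˡ _)
  fromℤ-* i         (+ zero)  = trans (reflexive (≡.cong fromℤ (ℤ.*-zeroʳ i))) (sym (zeroʳ _))
  fromℤ-* (+ suc m) (+ suc n) = ×1-homo-* (suc m) (suc n)
  fromℤ-* (+ suc m) -[1+ n ]  = trans (-‿cong (×1-homo-* (suc m) (suc n))) (-‿distribʳ-* _ _)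
  fromℤ-* -[1+ m ]  (+ suc n) = trans (-‿cong (×1-homo-* (suc m) (suc n))) (-‿distribˡ-* _ _)
  fromℤ-* -[1+ m ]  -[1+ n ]  = begin
    (suc m ℕ.* suc n) · 1#               ≈⟨ ×1-homo-* (suc m) (suc n) ⟩
    suc m · 1# * suc n · 1#              ≈⟨ ⁻¹-involutive _ ⟨
    - - (suc m · 1# * suc n · 1#)        ≈⟨ -‿cong (-‿distribˡ-* _ _) ⟩
    - (- (suc m · 1#) * suc n · 1#)      ≈⟨ -‿distribʳ-* _ _ ⟩
    - (suc m · 1#) * - (suc n · 1#)      ∎

  fromℤ-neg : ∀ i → fromℤ (ℤ.- i) ≈ - fromℤ i
  fromℤ-neg (+ zero)  = sym ε⁻¹≈ε
  fromℤ-neg (+ suc n) = refl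
  fromℤ-neg -[1+ n ]  = sym (⁻¹-involutive _)

  fromℤ-morphism : ℤ.+-*-rawRing -Raw-AlmostCommutative⟶ fromCommutativeRing R
  fromℤ-morphism = record
    { ⟦_⟧    = fromℤ
    ; +-homo = fromℤ-+
    ; *-homo = fromℤ-*
    ; -‿homo = fromℤ-neg
    ; 0-homo = refl
    ; 1-homo = refl
    }

  fromℤ-≟ : WeaklyDecidable (Induced-equivalence fromℤ-morphism)
  fromℤ-≟ i j with i ℤ.≟ j
  ... | yes ≡.refl = just refl
  ... | no _       = nothing

  open RingSolver ℤ.+-*-rawRing (fromCommutativeRing R) fromℤ-morphism fromℤ-≟ public
    using (Polynomial; solve; _:=_; _:+_; _:*_; :-_; _:-_; con)

  :0 :1 : ∀ {n} → Polynomial n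
  :0 = con (+ 0)
  :1 = con (+ 1)

module _ {c ℓ₁ ℓ₂} (F : OrderedField c ℓ₁ ℓ₂) where

  open OrderedField F hiding (zero; _≤_)
  open Poly F
  open IsTotalOrder isTotalOrder using (total; antisym)
    renaming (reflexive to ≤-reflexive; trans to ≤-trans; ≲-respˡ-≈ to ≤-respˡ-≈; ≲-respʳ-≈ to ≤-respʳ-≈)
  open GroupProperties +-group using (⁻¹-involutive)
  open RingProperties ring using (-‿distribˡ-*; -‿distribʳ-*; -1*x≈-x)
  open CommutativeSemigroupProperties *-commutativeSemigroup using (x∙yz≈y∙xz)
  open SemiringSum semiring
    using (sum; sum-cong-≋; sum-cong-≗; sum-replicate-zero; sum-init-last; ∑-distrib-+; *-distribˡ-sum; *-distribʳ-sum)
    renaming (∑-comm to SemiringSumComm)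
  open IntegerRingSolver commutativeRing using (solve; _:=_; _:+_; _:*_; :-_; _:-_; :0; :1)
  open import Relation.Binary.Reasoning.Setoid setoid

  private
    -- The field order carries no fixity declaration; this alias lets 0# ≤ x + y parse.
    infix 4 _≤_
    _≤_ : Rel Carrier ℓ₂
    _≤_ = OrderedField._≤_ F

    module ℕ+ = CommutativeSemigroupProperties ℕ.+-commutativeSemigroup

  private variable
    x y : Carrier
    φ ψ : Carrier → Carrier
    M σ : ℕ

  ≉0-resp-≈ : x ≈ y → x ≉ 0# → y ≉ 0#
  ≉0-resp-≈ x≈y x≉0 y≈0 = x≉0 (trans x≈y y≈0)

  0≤x⇒-x≤0 : 0# ≤ x → - x ≤ 0#
  0≤x⇒-x≤0 {x} 0≤x = ≤-respˡ-≈ (+-identityˡ _) (≤-respʳ-≈ (-‿inverseʳ x) (+-mono-≤ (- x) 0≤x))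

  x≤0⇒0≤-x : x ≤ 0# → 0# ≤ - x
  x≤0⇒0≤-x {x} x≤0 = ≤-respˡ-≈ (-‿inverseʳ x) (≤-respʳ-≈ (+-identityˡ _) (+-mono-≤ (- x) x≤0))

  +-nonneg : 0# ≤ x → 0# ≤ y → 0# ≤ x + y
  +-nonneg {x} {y} 0≤x 0≤y = ≤-trans 0≤y (≤-respˡ-≈ (+-identityˡ y) (+-mono-≤ y 0≤x))

  nonneg-x+y≈0⇒y≈0 : 0# ≤ x → 0# ≤ y → x + y ≈ 0# → y ≈ 0#
  nonneg-x+y≈0⇒y≈0 {x} {y} 0≤x 0≤y x+y≈0 = antisym y≤0 0≤y
    where
    y≈-x : y ≈ - x
    y≈-x = begin
      y             ≈⟨ solve 2 (λ x y → y := :- x :+ (x :+ y)) refl x y ⟩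
      - x + (x + y) ≈⟨ +-congˡ x+y≈0 ⟩
      - x + 0#      ≈⟨ +-identityʳ _ ⟩
      - x           ∎
    y≤0 : y ≤ 0#
    y≤0 = ≤-respˡ-≈ (sym y≈-x) (0≤x⇒-x≤0 0≤x)

  +-nonzero : 0# ≤ x → 0# ≤ y → x ≉ 0# ⊎ y ≉ 0# → x + y ≉ 0#
  +-nonzero 0≤x 0≤y (inj₁ x≉0) x+y≈0 = x≉0 (nonneg-x+y≈0⇒y≈0 0≤y 0≤x (trans (+-comm _ _) x+y≈0))
  +-nonzero 0≤x 0≤y (inj₂ y≉0) x+y≈0 = y≉0 (nonneg-x+y≈0⇒y≈0 0≤x 0≤y x+y≈0)

  1≉0 : 1# ≉ 0#
  1≉0 1≈0 = 0≉1 (sym 1≈0)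

  0≤1 : 0# ≤ 1#
  0≤1 with total 0# 1#
  ... | inj₁ 0≤1 = 0≤1
  ... | inj₂ 1≤0 = ≤-respʳ-≈ (solve 0 (:- :1 :* :- :1 := :1) refl)
                              (*-nonneg (x≤0⇒0≤-x 1≤0) (x≤0⇒0≤-x 1≤0))

  0≤fromℕ : ∀ n → 0# ≤ fromℕ n
  0≤fromℕ zero    = ≤-reflexive refl
  0≤fromℕ (suc n) = +-nonneg 0≤1 (0≤fromℕ n)

  fromℕ-suc≉0 : ∀ n → fromℕ (suc n) ≉ 0#
  fromℕ-suc≉0 n = +-nonzero 0≤1 (0≤fromℕ n) (inj₁ 1≉0)

  x≉0∧x*y≈0⇒y≈0 : x ≉ 0# → x * y ≈ 0# → y ≈ 0#
  x≉0∧x*y≈0⇒y≈0 {x} {y} x≉0 xy≈0 with inverse x x≉0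
  ... | x⁻¹ , xx⁻¹≈1 = begin
    y               ≈⟨ *-identityˡ y ⟨
    1# * y          ≈⟨ *-congʳ xx⁻¹≈1 ⟨
    (x * x⁻¹) * y   ≈⟨ solve 3 (λ x x⁻¹ y → (x :* x⁻¹) :* y := x⁻¹ :* (x :* y)) refl x x⁻¹ y ⟩
    x⁻¹ * (x * y)   ≈⟨ *-congˡ xy≈0 ⟩
    x⁻¹ * 0#        ≈⟨ zeroʳ _ ⟩
    0#              ∎

  *-nonzero : x ≉ 0# → y ≉ 0# → x * y ≉ 0#
  *-nonzero x≉0 y≉0 xy≈0 = y≉0 (x≉0∧x*y≈0⇒y≈0 x≉0 xy≈0)

  x*y≉0⇒y≉0 : x * y ≉ 0# → y ≉ 0#
  x*y≉0⇒y≉0 xy≉0 y≈0 = xy≉0 (trans (*-congˡ y≈0) (zeroʳ _))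

  0≤x*y⇒0≤y : 0# ≤ x → x ≉ 0# → 0# ≤ x * y → 0# ≤ y
  0≤x*y⇒0≤y {x} {y} 0≤x x≉0 0≤xy with total 0# y
  ... | inj₁ 0≤y = 0≤y
  ... | inj₂ y≤0 = ≤-reflexive (sym (x≉0∧x*y≈0⇒y≈0 x≉0 (antisym xy≤0 0≤xy)))
    where
    xy≤0 : x * y ≤ 0#
    xy≤0 = ≤-respˡ-≈ (⁻¹-involutive _)
             (0≤x⇒-x≤0 (≤-respʳ-≈ (sym (-‿distribʳ-* x y)) (*-nonneg 0≤x (x≤0⇒0≤-x y≤0))))

  sign : ℕ → Carrier
  sign zero    = 1#
  sign (suc n) = - sign n

  sign-+ : ∀ m n → sign (m ℕ.+ n) ≈ sign m * sign n
  sign-+ zero    n = sym (*-identityˡ _)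
  sign-+ (suc m) n = trans (-‿cong (sign-+ m n)) (-‿distribˡ-* _ _)

  sign*sign≈1 : ∀ n → sign n * sign n ≈ 1#
  sign*sign≈1 zero    = *-identityˡ 1#
  sign*sign≈1 (suc n) = trans (solve 1 (λ s → :- s :* :- s := s :* s) refl (sign n)) (sign*sign≈1 n)

  sign≉0 : ∀ n → sign n ≉ 0#
  sign≉0 n sign≈0 = 0≉1 (trans (sym (trans (*-congʳ sign≈0) (zeroˡ _))) (sign*sign≈1 n))

  sign-parity : ∀ n → (n % 2 ≡ 0 × sign n ≈ 1#) ⊎ (n % 2 ≡ 1 × sign n ≈ - 1#)
  sign-parity zero          = inj₁ (≡.refl , refl)
  sign-parity (suc zero)    = inj₂ (≡.refl , refl)
  sign-parity (suc (suc n)) with sign-parity n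
  ... | inj₁ (even , sign≈1)  = inj₁ (even , trans (⁻¹-involutive _) sign≈1)
  ... | inj₂ (odd  , sign≈-1) = inj₂ (odd  , trans (⁻¹-involutive _) sign≈-1)

  sign[k+σ]≈sign[j+σ]*sign[j+k] : ∀ j k σ → sign (k ℕ.+ σ) ≈ sign (j ℕ.+ σ) * sign (j ℕ.+ k)
  sign[k+σ]≈sign[j+σ]*sign[j+k] j k σ = begin
    sign (k ℕ.+ σ)                        ≈⟨ sign-+ k σ ⟩
    sign k * sign σ                       ≈⟨ *-identityˡ _ ⟨
    1# * (sign k * sign σ)                ≈⟨ *-congʳ (sign*sign≈1 j) ⟨
    (sign j * sign j) * (sign k * sign σ) ≈⟨ solve 3 (λ a b c → (a :* a) :* (b :* c) := (a :* c) :* (a :* b))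
                                                      refl (sign j) (sign k) (sign σ) ⟩
    (sign j * sign σ) * (sign j * sign k) ≈⟨ *-cong (sign-+ j σ) (sign-+ j k) ⟨
    sign (j ℕ.+ σ) * sign (j ℕ.+ k)       ∎

  -- Opaque, so that a sum over suc N is not unfolded when Agda infers the summands.
  infix 6 ∑<
  opaque
    ∑< : ∀ N → Vector Carrier N → Carrier
    ∑< N = sum

  syntax ∑< N (λ i → t) = ∑[ i < N ] t

  private variable
    N : ℕ
    t u : Vector Carrier N

  opaque
    unfolding ∑<

    ∑-cong : (∀ i → t i ≈ u i) → ∑< N t ≈ ∑< N u
    ∑-cong = sum-cong-≋

    ∑-suc : ∑< (suc N) t ≈ t Fin.zero + ∑< N (t ∘ Fin.suc)
    ∑-suc = refl

    ∑-+ : ∑[ i < N ] (t i + u i) ≈ ∑< N t + ∑< N u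
    ∑-+ {t = t} {u = u} = ∑-distrib-+ t u

    ∑-comm : ∀ {N′} (w : Fin N → Fin N′ → Carrier) →
             ∑[ i < N ] ∑[ j < N′ ] w i j ≈ ∑[ j < N′ ] ∑[ i < N ] w i j
    ∑-comm = SemiringSumComm

    *-distribˡ-∑ : ∀ x → x * ∑< N t ≈ ∑[ i < N ] (x * t i)
    *-distribˡ-∑ {t = t} x = *-distribˡ-sum x t

    *-distribʳ-∑ : ∀ x → ∑< N t * x ≈ ∑[ i < N ] (t i * x)
    *-distribʳ-∑ {t = t} x = *-distribʳ-sum x t

    ∑-≈0 : (∀ i → t i ≈ 0#) → ∑< N t ≈ 0#
    ∑-≈0 {N} t≈0 = trans (sum-cong-≋ t≈0) (sum-replicate-zero N)

    ∑-last : ∀ N (f : ℕ → Carrier) → ∑[ j < suc N ] f (toℕ j) ≈ (∑[ j < N ] f (toℕ j)) + f N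
    ∑-last N f = begin
      sum {suc N} (f ∘ toℕ)
        ≈⟨ sum-init-last (f ∘ toℕ) ⟩
      sum {N} (f ∘ toℕ ∘ Fin.inject₁) + f (toℕ (Fin.fromℕ N))
        ≡⟨ ≡.cong₂ _+_ (sum-cong-≗ {N} (λ j → ≡.cong f (Fin.toℕ-inject₁ j))) (≡.cong f (Fin.toℕ-fromℕ N)) ⟩
      sum {N} (f ∘ toℕ) + f N ∎

    ∑-nonneg : (∀ i → 0# ≤ t i) → 0# ≤ ∑< N t
    ∑-nonneg {zero}  _   = ≤-reflexive refl
    ∑-nonneg {suc N} t≥0 = +-nonneg (t≥0 Fin.zero) (∑-nonneg (t≥0 ∘ Fin.suc))

    sumFin≈∑ : ∀ N (t : Vector Carrier N) → sumFin N t ≈ ∑< N t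
    sumFin≈∑ zero    t = refl
    sumFin≈∑ (suc N) t = +-congˡ (sumFin≈∑ N (t ∘ Fin.suc))

  -- Falling factorials and forward differences

  falling : ℕ → Carrier → Carrier
  falling zero    x = 1#
  falling (suc j) x = falling j x * (x - fromℕ j)

  falling-suc-0 : ∀ j → falling (suc j) 0# ≈ 0#
  falling-suc-0 zero    = solve 0 (:1 :* (:0 :- :0) := :0) refl
  falling-suc-0 (suc j) = trans (*-congʳ (falling-suc-0 j)) (zeroˡ _)

  falling-1+ : ∀ j x → falling (suc j) (1# + x) ≈ (1# + x) * falling j x
  falling-1+ zero    x = solve 1 (λ x → :1 :* ((:1 :+ x) :- :0) := (:1 :+ x) :* :1) refl x
  falling-1+ (suc j) x = trans (*-congʳ (falling-1+ j x))
    (solve 3 (λ x p n → ((:1 :+ x) :* p) :* ((:1 :+ x) :- (:1 :+ n)) := (:1 :+ x) :* (p :* (x :- n)))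
             refl x (falling j x) (fromℕ j))

  falling-Δ : ∀ j x → falling (suc j) (1# + x) ≈ falling (suc j) x + fromℕ (suc j) * falling j x
  falling-Δ j x = trans (falling-1+ j x)
    (solve 3 (λ x p n → (:1 :+ x) :* p := p :* (x :- n) :+ (:1 :+ n) :* p) refl x (falling j x) (fromℕ j))

  x*falling : ∀ j x → x * falling j x ≈ falling (suc j) x + fromℕ j * falling j x
  x*falling j x = solve 3 (λ x p n → x :* p := p :* (x :- n) :+ n :* p) refl x (falling j x) (fromℕ j)

  newton : ℕ → (ℕ → Carrier) → Carrier → Carrier
  newton M β x = ∑[ j < suc M ] β (toℕ j) * falling (toℕ j) x

  newton-at-0 : ∀ M β → newton M β 0# ≈ β 0
  newton-at-0 M β = begin
    newton M β 0#
      ≈⟨ ∑-suc ⟩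
    β 0 * 1# + (∑[ j < M ] β (suc (toℕ j)) * falling (suc (toℕ j)) 0#)
      ≈⟨ +-cong (*-identityʳ _) (∑-≈0 (λ j → trans (*-congˡ (falling-suc-0 (toℕ j))) (zeroʳ _))) ⟩
    β 0 + 0#
      ≈⟨ +-identityʳ _ ⟩
    β 0 ∎

  newton-constant : ∀ β x → newton 0 β x ≈ β 0
  newton-constant β x = trans ∑-suc (trans (+-cong (*-identityʳ _) (∑-≈0 (λ ()))) (+-identityʳ _))

  Δ : (Carrier → Carrier) → Carrier → Carrier
  Δ φ x = φ (1# + x) - φ x

  Δcoeffs : (ℕ → Carrier) → ℕ → Carrier
  Δcoeffs β j = fromℕ (suc j) * β (suc j)

  newton-1+ : ∀ M β x → newton (suc M) β (1# + x) ≈ newton (suc M) β x + newton M (Δcoeffs β) x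
  newton-1+ M β x = begin
    newton (suc M) β (1# + x)
      ≈⟨ ∑-suc ⟩
    β 0 * 1# + (∑[ j < suc M ] β (suc (toℕ j)) * falling (suc (toℕ j)) (1# + x))
      ≈⟨ +-congˡ (∑-cong (λ j → term (toℕ j))) ⟩
    β 0 * 1# + (∑[ j < suc M ] (β (suc (toℕ j)) * falling (suc (toℕ j)) x + Δcoeffs β (toℕ j) * falling (toℕ j) x))
      ≈⟨ +-congˡ ∑-+ ⟩
    β 0 * 1# + ((∑[ j < suc M ] β (suc (toℕ j)) * falling (suc (toℕ j)) x) + newton M (Δcoeffs β) x)
      ≈⟨ +-assoc _ _ _ ⟨
    (β 0 * 1# + (∑[ j < suc M ] β (suc (toℕ j)) * falling (suc (toℕ j)) x)) + newton M (Δcoeffs β) x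
      ≈⟨ +-congʳ ∑-suc ⟨
    newton (suc M) β x + newton M (Δcoeffs β) x ∎
    where
    term : ∀ j → β (suc j) * falling (suc j) (1# + x) ≈ β (suc j) * falling (suc j) x + Δcoeffs β j * falling j x
    term j = trans (*-congˡ (falling-Δ j x))
      (solve 4 (λ b p n q → b :* (p :+ n :* q) := b :* p :+ n :* b :* q) refl
               (β (suc j)) (falling (suc j) x) (fromℕ (suc j)) (falling j x))

  newton-Δ : ∀ M β x → Δ (newton (suc M) β) x ≈ newton M (Δcoeffs β) x
  newton-Δ M β x = trans (+-congʳ (newton-1+ M β x)) (solve 2 (λ p d → (p :+ d) :- p := d) refl _ _)

  Alternating : ℕ → ℕ → (Carrier → Carrier) → Set ℓ₂
  Alternating M σ φ = ∀ {a} → a ℕ.≤ M → 0# ≤ sign (a ℕ.+ σ) * φ (fromℕ a)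

  Alternating-cong : (∀ x → φ x ≈ ψ x) → Alternating M σ φ → Alternating M σ ψ
  Alternating-cong φ≈ψ alt a≤M = ≤-respʳ-≈ (*-congˡ (φ≈ψ _)) (alt a≤M)

  sign*Δ : ∀ φ a σ → sign (a ℕ.+ suc σ) * Δ φ (fromℕ a)
                       ≈ sign (suc a ℕ.+ σ) * φ (fromℕ (suc a)) + sign (a ℕ.+ σ) * φ (fromℕ a)
  sign*Δ φ a σ = begin
    sign (a ℕ.+ suc σ) * Δ φ (fromℕ a)
      ≡⟨ ≡.cong (λ k → sign k * Δ φ (fromℕ a)) (ℕ.+-suc a σ) ⟩
    - sign (a ℕ.+ σ) * (φ (1# + fromℕ a) - φ (fromℕ a))
      ≈⟨ solve 3 (λ s p q → :- s :* (p :- q) := :- s :* p :+ s :* q) refl (sign (a ℕ.+ σ)) _ _ ⟩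
    sign (suc a ℕ.+ σ) * φ (fromℕ (suc a)) + sign (a ℕ.+ σ) * φ (fromℕ a) ∎

  Δ-alternating : Alternating (suc M) σ φ → Alternating M (suc σ) (Δ φ)
  Δ-alternating {σ = σ} {φ = φ} alt {a} a≤M =
    ≤-respʳ-≈ (sym (sign*Δ φ a σ)) (+-nonneg (alt (s≤s a≤M)) (alt (ℕ.m≤n⇒m≤1+n a≤M)))

  Δ≉0 : Alternating (suc M) σ φ → ∀ {a} → a ℕ.≤ M →
        sign (suc a ℕ.+ σ) * φ (fromℕ (suc a)) ≉ 0# ⊎ sign (a ℕ.+ σ) * φ (fromℕ a) ≉ 0# →
        Δ φ (fromℕ a) ≉ 0#
  Δ≉0 {σ = σ} {φ = φ} alt {a} a≤M summand≉0 =
    x*y≉0⇒y≉0 (≉0-resp-≈ (sym (sign*Δ φ a σ))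
                           (+-nonzero (alt (s≤s a≤M)) (alt (ℕ.m≤n⇒m≤1+n a≤M)) summand≉0))

  Δ-nonvanishing : Alternating (suc M) σ φ → ∀ {a} → a ℕ.≤ suc M → φ (fromℕ a) ≉ 0# →
                   ∃[ b ] b ℕ.≤ M × Δ φ (fromℕ b) ≉ 0#
  Δ-nonvanishing {σ = σ} {φ = φ} alt {zero} _ φ0≉0 =
    0 , z≤n , Δ≉0 {φ = φ} alt z≤n (inj₂ (*-nonzero (sign≉0 σ) φ0≉0))
  Δ-nonvanishing {σ = σ} {φ = φ} alt {suc a} (s≤s a≤M) φa≉0 =
    a , a≤M , Δ≉0 {φ = φ} alt a≤M (inj₁ (*-nonzero (sign≉0 (suc a ℕ.+ σ)) φa≉0))

  newton-Δ-alternating : ∀ {β} → Alternating (suc M) σ (newton (suc M) β) →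
                         Alternating M (suc σ) (newton M (Δcoeffs β))
  newton-Δ-alternating {M} {β = β} alt = Alternating-cong (newton-Δ M β) (Δ-alternating {φ = newton (suc M) β} alt)

  newton-coeff-sign : ∀ M β σ → Alternating M σ (newton M β) → ∀ {j} → j ℕ.≤ M → 0# ≤ sign (j ℕ.+ σ) * β j
  newton-coeff-sign M β σ alt {zero} _ = ≤-respʳ-≈ (*-congˡ (newton-at-0 M β)) (alt z≤n)
  newton-coeff-sign (suc M) β σ alt {suc j} (s≤s j≤M) =
    0≤x*y⇒0≤y (0≤fromℕ (suc j)) (fromℕ-suc≉0 j)
      (≤-respʳ-≈ reorder (newton-coeff-sign M (Δcoeffs β) (suc σ) (newton-Δ-alternating {β = β} alt) j≤M))
    where
    reorder : sign (j ℕ.+ suc σ) * Δcoeffs β j ≈ fromℕ (suc j) * (sign (suc j ℕ.+ σ) * β (suc j))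
    reorder = begin
      sign (j ℕ.+ suc σ) * (fromℕ (suc j) * β (suc j)) ≡⟨ ≡.cong (λ k → sign k * Δcoeffs β j) (ℕ.+-suc j σ) ⟩
      sign (suc j ℕ.+ σ) * (fromℕ (suc j) * β (suc j)) ≈⟨ x∙yz≈y∙xz _ _ _ ⟩
      fromℕ (suc j) * (sign (suc j ℕ.+ σ) * β (suc j)) ∎

  newton-top-coeff≉0 : ∀ M β σ → Alternating M σ (newton M β) →
                       ∀ {a} → a ℕ.≤ M → newton M β (fromℕ a) ≉ 0# → β M ≉ 0#
  newton-top-coeff≉0 zero    β σ alt _  ≉0 = ≉0-resp-≈ (newton-constant β _) ≉0
  newton-top-coeff≉0 (suc M) β σ alt a≤ ≉0 with Δ-nonvanishing {φ = newton (suc M) β} alt a≤ ≉0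
  ... | b , b≤M , Δ≉0′ = x*y≉0⇒y≉0 (newton-top-coeff≉0 M (Δcoeffs β) (suc σ) (newton-Δ-alternating {β = β} alt)
                                                       b≤M (≉0-resp-≈ (newton-Δ M β _) Δ≉0′))

  -- Stirling numbers

  shifted : (ℕ → Carrier) → ℕ → Carrier
  shifted f zero    = 0#
  shifted f (suc k) = f k

  δ : ℕ → ℕ → Carrier
  δ zero    zero    = 1#
  δ zero    (suc k) = 0#
  δ (suc i) zero    = 0#
  δ (suc i) (suc k) = δ i k

  stirling₂ : ℕ → ℕ → Carrier
  stirling₂ zero    j = δ zero j
  stirling₂ (suc i) j = shifted (stirling₂ i) j + fromℕ j * stirling₂ i j

  stirling₁ : ℕ → ℕ → Carrier
  stirling₁ zero    k = δ zero k
  stirling₁ (suc j) k = shifted (stirling₁ j) k - fromℕ j * stirling₁ j k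

  stirling₂-vanishes : ∀ {i j} → i ℕ.< j → stirling₂ i j ≈ 0#
  stirling₂-vanishes {zero}  {suc j} _         = refl
  stirling₂-vanishes {suc i} {suc j} (s<s i<j) = begin
    stirling₂ i j + fromℕ (suc j) * stirling₂ i (suc j)
      ≈⟨ +-cong (stirling₂-vanishes i<j) (*-congˡ (stirling₂-vanishes (ℕ.m<n⇒m<1+n i<j))) ⟩
    0# + fromℕ (suc j) * 0#
      ≈⟨ trans (+-identityˡ _) (zeroʳ _) ⟩
    0# ∎

  ∑-stirling₂-zero : ∀ N (f : ℕ → Carrier) → ∑[ j < suc N ] stirling₂ 0 (toℕ j) * f (toℕ j) ≈ f 0
  ∑-stirling₂-zero N f = begin
    ∑[ j < suc N ] stirling₂ 0 (toℕ j) * f (toℕ j)  ≈⟨ ∑-suc ⟩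
    1# * f 0 + (∑[ j < N ] 0# * f (suc (toℕ j)))    ≈⟨ +-cong (*-identityˡ _) (∑-≈0 (λ _ → zeroˡ _)) ⟩
    f 0 + 0#                                        ≈⟨ +-identityʳ _ ⟩
    f 0                                             ∎

  ∑-shifted : ∀ N f (g : ℕ → Carrier) → f N ≈ 0# →
              ∑[ j < suc N ] shifted f (toℕ j) * g (toℕ j) ≈ ∑[ j < suc N ] f (toℕ j) * g (suc (toℕ j))
  ∑-shifted N f g fN≈0 = begin
    ∑[ j < suc N ] shifted f (toℕ j) * g (toℕ j)                ≈⟨ ∑-suc ⟩
    0# * g 0 + (∑[ j < N ] f (toℕ j) * g (suc (toℕ j)))         ≈⟨ trans (+-congʳ (zeroˡ _)) (+-identityˡ _) ⟩
    ∑[ j < N ] f (toℕ j) * g (suc (toℕ j))                      ≈⟨ +-identityʳ _ ⟨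
    (∑[ j < N ] f (toℕ j) * g (suc (toℕ j))) + 0#               ≈⟨ +-congˡ (trans (*-congʳ fN≈0) (zeroˡ _)) ⟨
    (∑[ j < N ] f (toℕ j) * g (suc (toℕ j))) + f N * g (suc N)  ≈⟨ ∑-last N (λ j → f j * g (suc j)) ⟨
    ∑[ j < suc N ] f (toℕ j) * g (suc (toℕ j))                  ∎

  ∑-stirling₂-suc : ∀ N i (g : ℕ → Carrier) → suc i ℕ.< N →
                    ∑[ j < N ] stirling₂ (suc i) (toℕ j) * g (toℕ j)
                      ≈ ∑[ j < N ] stirling₂ i (toℕ j) * (g (suc (toℕ j)) + fromℕ (toℕ j) * g (toℕ j))
  ∑-stirling₂-suc (suc N) i g (s<s i<N) = begin
    ∑[ j < suc N ] stirling₂ (suc i) (toℕ j) * g (toℕ j)           ≈⟨ ∑-cong (λ j → expand (toℕ j)) ⟩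
    ∑[ j < suc N ] (shiftedTerm (toℕ j) + scaledTerm (toℕ j))      ≈⟨ ∑-+ ⟩
    (∑[ j < suc N ] shiftedTerm (toℕ j)) + (∑[ j < suc N ] scaledTerm (toℕ j))
      ≈⟨ +-congʳ (∑-shifted N (stirling₂ i) g (stirling₂-vanishes i<N)) ⟩
    (∑[ j < suc N ] stirling₂ i (toℕ j) * g (suc (toℕ j))) + (∑[ j < suc N ] scaledTerm (toℕ j))
      ≈⟨ ∑-+ ⟨
    ∑[ j < suc N ] (stirling₂ i (toℕ j) * g (suc (toℕ j)) + scaledTerm (toℕ j))
      ≈⟨ ∑-cong (λ j → distribˡ _ _ _) ⟨
    ∑[ j < suc N ] stirling₂ i (toℕ j) * (g (suc (toℕ j)) + fromℕ (toℕ j) * g (toℕ j)) ∎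
    where
    shiftedTerm scaledTerm : ℕ → Carrier
    shiftedTerm j = shifted (stirling₂ i) j * g j
    scaledTerm  j = stirling₂ i j * (fromℕ j * g j)
    expand : ∀ j → stirling₂ (suc i) j * g j ≈ shiftedTerm j + scaledTerm j
    expand j = solve 4 (λ a n b x → (a :+ n :* b) :* x := a :* x :+ b :* (n :* x)) refl
                 (shifted (stirling₂ i) j) (fromℕ j) (stirling₂ i j) (g j)

  pow≈∑stirling₂ : ∀ N i x → i ℕ.< N → pow x i ≈ ∑[ j < N ] stirling₂ i (toℕ j) * falling (toℕ j) x
  pow≈∑stirling₂ (suc N) zero    x _    = sym (∑-stirling₂-zero N (λ j → falling j x))
  pow≈∑stirling₂ N       (suc i) x i<N = begin
    x * pow x i
      ≈⟨ *-congˡ (pow≈∑stirling₂ N i x (ℕ.<⇒≤ i<N)) ⟩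
    x * (∑[ j < N ] stirling₂ i (toℕ j) * falling (toℕ j) x)
      ≈⟨ *-distribˡ-∑ x ⟩
    ∑[ j < N ] x * (stirling₂ i (toℕ j) * falling (toℕ j) x)
      ≈⟨ ∑-cong (λ j → trans (x∙yz≈y∙xz _ _ _) (*-congˡ (x*falling (toℕ j) x))) ⟩
    ∑[ j < N ] stirling₂ i (toℕ j) * (falling (suc (toℕ j)) x + fromℕ (toℕ j) * falling (toℕ j) x)
      ≈⟨ ∑-stirling₂-suc N i (λ j → falling j x) i<N ⟨
    ∑[ j < N ] stirling₂ (suc i) (toℕ j) * falling (toℕ j) x ∎

  stirling₂∘stirling₁≈δ : ∀ N i k → i ℕ.< N →
                          ∑[ j < N ] stirling₂ i (toℕ j) * stirling₁ (toℕ j) k ≈ δ i k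
  stirling₂∘stirling₁≈δ (suc N) zero    k _    = ∑-stirling₂-zero N (λ j → stirling₁ j k)
  stirling₂∘stirling₁≈δ N       (suc i) k i<N = begin
    ∑[ j < N ] stirling₂ (suc i) (toℕ j) * stirling₁ (toℕ j) k
      ≈⟨ ∑-stirling₂-suc N i (λ j → stirling₁ j k) i<N ⟩
    ∑[ j < N ] stirling₂ i (toℕ j) * (stirling₁ (suc (toℕ j)) k + fromℕ (toℕ j) * stirling₁ (toℕ j) k)
      ≈⟨ ∑-cong (λ j → *-congˡ (solve 2 (λ a b → (a :- b) :+ b := a) refl _ _)) ⟩
    ∑[ j < N ] stirling₂ i (toℕ j) * shifted (stirling₁ (toℕ j)) k
      ≈⟨ shifted-row k ⟩
    δ (suc i) k ∎
    where
    shifted-row : ∀ k → ∑[ j < N ] stirling₂ i (toℕ j) * shifted (stirling₁ (toℕ j)) k ≈ δ (suc i) k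
    shifted-row zero    = ∑-≈0 (λ _ → zeroʳ _)
    shifted-row (suc k) = stirling₂∘stirling₁≈δ N i k (ℕ.<⇒≤ i<N)

  ∑-δ : ∀ {N} (c : Fin N → Carrier) k → ∑[ i < N ] c i * δ (toℕ i) (toℕ k) ≈ c k
  ∑-δ c Fin.zero    = trans ∑-suc (trans (+-cong (*-identityʳ _) (∑-≈0 (λ _ → zeroʳ _))) (+-identityʳ _))
  ∑-δ c (Fin.suc k) = trans ∑-suc (trans (+-cong (zeroʳ _) (∑-δ (c ∘ Fin.suc) k)) (+-identityˡ _))

  ∣stirling₁∣ : ℕ → ℕ → Carrier
  ∣stirling₁∣ j k = sign (j ℕ.+ k) * stirling₁ j k

  ∣stirling₁∣-suc : ∀ j k →
                    ∣stirling₁∣ (suc j) (suc k) ≈ ∣stirling₁∣ j k + fromℕ j * ∣stirling₁∣ j (suc k)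
  ∣stirling₁∣-suc j k = begin
    - sign (j ℕ.+ suc k) * (stirling₁ j k - fromℕ j * stirling₁ j (suc k))
      ≈⟨ solve 4 (λ s a n b → :- s :* (a :- n :* b) := :- s :* a :+ n :* (s :* b)) refl _ _ _ _ ⟩
    - sign (j ℕ.+ suc k) * stirling₁ j k + fromℕ j * ∣stirling₁∣ j (suc k)
      ≈⟨ +-congʳ (*-congʳ -sign[j+1+k]≈sign[j+k]) ⟩
    ∣stirling₁∣ j k + fromℕ j * ∣stirling₁∣ j (suc k) ∎
    where
    -sign[j+1+k]≈sign[j+k] : - sign (j ℕ.+ suc k) ≈ sign (j ℕ.+ k)
    -sign[j+1+k]≈sign[j+k] = trans (reflexive (≡.cong (-_ ∘ sign) (ℕ.+-suc j k))) (⁻¹-involutive _)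

  ∣stirling₁∣-suc-0 : ∀ j → ∣stirling₁∣ (suc j) 0 ≈ fromℕ j * ∣stirling₁∣ j 0
  ∣stirling₁∣-suc-0 j =
    solve 3 (λ s n a → :- s :* (:0 :- n :* a) := n :* (s :* a)) refl (sign (j ℕ.+ 0)) (fromℕ j) (stirling₁ j 0)

  ∣stirling₁∣-nonneg : ∀ j k → 0# ≤ ∣stirling₁∣ j k
  ∣stirling₁∣-nonneg zero    zero    = ≤-respʳ-≈ (sym (*-identityˡ 1#)) 0≤1
  ∣stirling₁∣-nonneg zero    (suc k) = ≤-respʳ-≈ (sym (zeroʳ _)) (≤-reflexive refl)
  ∣stirling₁∣-nonneg (suc j) zero    =
    ≤-respʳ-≈ (sym (∣stirling₁∣-suc-0 j)) (*-nonneg (0≤fromℕ j) (∣stirling₁∣-nonneg j 0))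
  ∣stirling₁∣-nonneg (suc j) (suc k) =
    ≤-respʳ-≈ (sym (∣stirling₁∣-suc j k))
              (+-nonneg (∣stirling₁∣-nonneg j k) (*-nonneg (0≤fromℕ j) (∣stirling₁∣-nonneg j (suc k))))

  ∣stirling₁∣-nonzero : ∀ {j k} → suc k ℕ.≤ j → ∣stirling₁∣ j (suc k) ≉ 0#
  ∣stirling₁∣-nonzero {suc j} {k} (s≤s k≤j) =
    ≉0-resp-≈ (sym (∣stirling₁∣-suc j k))
      (+-nonzero (∣stirling₁∣-nonneg j k) (*-nonneg (0≤fromℕ j) (∣stirling₁∣-nonneg j (suc k)))
                 (summand≉0 j k k≤j))
    where
    summand≉0 : ∀ j k → k ℕ.≤ j → ∣stirling₁∣ j k ≉ 0# ⊎ fromℕ j * ∣stirling₁∣ j (suc k) ≉ 0#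
    summand≉0 zero    zero    _   = inj₁ (≉0-resp-≈ (sym (*-identityˡ 1#)) 1≉0)
    summand≉0 (suc j) zero    _   = inj₂ (*-nonzero (fromℕ-suc≉0 j) (∣stirling₁∣-nonzero {suc j} {0} (s≤s z≤n)))
    summand≉0 j       (suc k) k<j = inj₁ (∣stirling₁∣-nonzero k<j)

  -- One variable

  eval₁ : ∀ {N} → (Fin N → Carrier) → Carrier → Carrier
  eval₁ {N} c x = ∑[ i < N ] c i * pow x (toℕ i)

  newtonCoeffs : ∀ {N} → (Fin N → Carrier) → ℕ → Carrier
  newtonCoeffs {N} c j = ∑[ i < N ] c i * stirling₂ (toℕ i) j

  eval₁≈newton : ∀ {M} (c : Fin (suc M) → Carrier) x → eval₁ c x ≈ newton M (newtonCoeffs c) x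
  eval₁≈newton {M} c x = begin
    ∑[ i < suc M ] c i * pow x (toℕ i)
      ≈⟨ ∑-cong (λ i → *-congˡ (pow≈∑stirling₂ (suc M) (toℕ i) x (Fin.toℕ<n i))) ⟩
    ∑[ i < suc M ] c i * (∑[ j < suc M ] stirling₂ (toℕ i) (toℕ j) * falling (toℕ j) x)
      ≈⟨ ∑-cong (λ i → *-distribˡ-∑ (c i)) ⟩
    ∑[ i < suc M ] ∑[ j < suc M ] c i * (stirling₂ (toℕ i) (toℕ j) * falling (toℕ j) x)
      ≈⟨ ∑-comm _ ⟩
    ∑[ j < suc M ] ∑[ i < suc M ] c i * (stirling₂ (toℕ i) (toℕ j) * falling (toℕ j) x)
      ≈⟨ ∑-cong (λ j → trans (∑-cong (λ i → sym (*-assoc _ _ _))) (sym (*-distribʳ-∑ _))) ⟩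
    ∑[ j < suc M ] newtonCoeffs c (toℕ j) * falling (toℕ j) x ∎

  coeff≈∑newtonCoeffs : ∀ {M} (c : Fin (suc M) → Carrier) k →
                        c k ≈ ∑[ j < suc M ] newtonCoeffs c (toℕ j) * stirling₁ (toℕ j) (toℕ k)
  coeff≈∑newtonCoeffs {M} c k = sym (begin
    ∑[ j < suc M ] (∑[ i < suc M ] c i * stirling₂ (toℕ i) (toℕ j)) * stirling₁ (toℕ j) (toℕ k)
      ≈⟨ ∑-cong (λ j → trans (*-distribʳ-∑ _) (∑-cong (λ i → *-assoc _ _ _))) ⟩
    ∑[ j < suc M ] ∑[ i < suc M ] c i * (stirling₂ (toℕ i) (toℕ j) * stirling₁ (toℕ j) (toℕ k))
      ≈⟨ ∑-comm _ ⟩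
    ∑[ i < suc M ] ∑[ j < suc M ] c i * (stirling₂ (toℕ i) (toℕ j) * stirling₁ (toℕ j) (toℕ k))
      ≈⟨ ∑-cong (λ i → sym (*-distribˡ-∑ (c i))) ⟩
    ∑[ i < suc M ] c i * (∑[ j < suc M ] stirling₂ (toℕ i) (toℕ j) * stirling₁ (toℕ j) (toℕ k))
      ≈⟨ ∑-cong (λ i → *-congˡ (stirling₂∘stirling₁≈δ (suc M) (toℕ i) (toℕ k) (Fin.toℕ<n i))) ⟩
    ∑[ i < suc M ] c i * δ (toℕ i) (toℕ k)
      ≈⟨ ∑-δ c k ⟩
    c k ∎)

  signedNewtonTerm : (ℕ → Carrier) → ℕ → ℕ → ℕ → Carrier
  signedNewtonTerm β σ k j = (sign (j ℕ.+ σ) * β j) * ∣stirling₁∣ j k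

  sign*coeff≈∑ : ∀ {M} (c : Fin (suc M) → Carrier) σ k →
                 sign (toℕ k ℕ.+ σ) * c k ≈ ∑[ j < suc M ] signedNewtonTerm (newtonCoeffs c) σ (toℕ k) (toℕ j)
  sign*coeff≈∑ {M} c σ k = begin
    sign (toℕ k ℕ.+ σ) * c k
      ≈⟨ *-congˡ (coeff≈∑newtonCoeffs c k) ⟩
    sign (toℕ k ℕ.+ σ) * (∑[ j < suc M ] newtonCoeffs c (toℕ j) * stirling₁ (toℕ j) (toℕ k))
      ≈⟨ *-distribˡ-∑ _ ⟩
    ∑[ j < suc M ] sign (toℕ k ℕ.+ σ) * (newtonCoeffs c (toℕ j) * stirling₁ (toℕ j) (toℕ k))
      ≈⟨ ∑-cong (λ j → regroup (toℕ j)) ⟩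
    ∑[ j < suc M ] signedNewtonTerm (newtonCoeffs c) σ (toℕ k) (toℕ j) ∎
    where
    regroup : ∀ j → sign (toℕ k ℕ.+ σ) * (newtonCoeffs c j * stirling₁ j (toℕ k))
                      ≈ signedNewtonTerm (newtonCoeffs c) σ (toℕ k) j
    regroup j = trans (*-congʳ (sign[k+σ]≈sign[j+σ]*sign[j+k] j (toℕ k) σ))
      (solve 4 (λ s t b u → (s :* t) :* (b :* u) := (s :* b) :* (t :* u)) refl
        (sign (j ℕ.+ σ)) (sign (j ℕ.+ toℕ k)) (newtonCoeffs c j) (stirling₁ j (toℕ k)))

  module _ {M σ} (c : Fin (suc M) → Carrier) (alt : Alternating M σ (eval₁ c)) where

    private
      β : ℕ → Carrier
      β = newtonCoeffs c

      newton-alt : Alternating M σ (newton M β)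
      newton-alt = Alternating-cong (eval₁≈newton c) alt

      term-nonneg : ∀ k {j} → j ℕ.≤ M → 0# ≤ signedNewtonTerm β σ k j
      term-nonneg k {j} j≤M = *-nonneg (newton-coeff-sign M β σ newton-alt j≤M) (∣stirling₁∣-nonneg j k)

    eval₁-coeff-sign : ∀ k → 0# ≤ sign (toℕ k ℕ.+ σ) * c k
    eval₁-coeff-sign k =
      ≤-respʳ-≈ (sym (sign*coeff≈∑ c σ k)) (∑-nonneg (λ j → term-nonneg (toℕ k) (Fin.toℕ≤pred[n] j)))

    eval₁-coeff≉0 : ∀ {a} → a ℕ.≤ M → eval₁ c (fromℕ a) ≉ 0# → ∀ (k : Fin M) → c (Fin.suc k) ≉ 0#
    eval₁-coeff≉0 a≤M p≉0 k = x*y≉0⇒y≉0 (≉0-resp-≈ (sym sign*coeff≈) sum≉0)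
      where
      K : ℕ
      K = suc (toℕ k)
      sign*coeff≈ : sign (K ℕ.+ σ) * c (Fin.suc k)
                      ≈ (∑[ j < M ] signedNewtonTerm β σ K (toℕ j)) + signedNewtonTerm β σ K M
      sign*coeff≈ = trans (sign*coeff≈∑ c σ (Fin.suc k)) (∑-last M (signedNewtonTerm β σ K))
      βM≉0 : β M ≉ 0#
      βM≉0 = newton-top-coeff≉0 M β σ newton-alt a≤M (≉0-resp-≈ (eval₁≈newton c _) p≉0)
      top≉0 : signedNewtonTerm β σ K M ≉ 0#
      top≉0 = *-nonzero (*-nonzero (sign≉0 (M ℕ.+ σ)) βM≉0) (∣stirling₁∣-nonzero (Fin.toℕ<n k))
      sum≉0 : (∑[ j < M ] signedNewtonTerm β σ K (toℕ j)) + signedNewtonTerm β σ K M ≉ 0#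
      sum≉0 = +-nonzero (∑-nonneg (λ j → term-nonneg K (ℕ.<⇒≤ (Fin.toℕ<n j)))) (term-nonneg K ℕ.≤-refl)
                        (inj₂ top≉0)

  -- Several variables

  -- Defined exactly like the sum inside Par, so that Par a reduces to weight a % 2.
  weight : ∀ {m n} → Vec (Fin m) n → ℕ
  weight = Vec.foldr _ (λ x s → toℕ x ℕ.+ s) 0

  ParityAlternating : ∀ {m n} → ℕ → Polynomial m n → Set ℓ₂
  ParityAlternating s P = ∀ a → 0# ≤ sign (s ℕ.+ weight a) * eval P a

  weaklySignRepresentsPar⇒parityAlternating : ∀ {m n} {P : Polynomial m n} →
                                              WeaklySignRepresentsPar P → ParityAlternating 0 P
  weaklySignRepresentsPar⇒parityAlternating (represents , _) a with sign-parity (weight a)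
  ... | inj₁ (even , sign≈1)  =
    ≤-respʳ-≈ (sym (trans (*-congʳ sign≈1) (*-identityˡ _))) (proj₁ (represents a) even)
  ... | inj₂ (odd  , sign≈-1) =
    ≤-respʳ-≈ (sym (trans (*-congʳ sign≈-1) (-1*x≈-x _))) (x≤0⇒0≤-x (proj₂ (represents a) odd))

  sumVec-cong : ∀ m n {f g : Vec (Fin m) n → Carrier} → (∀ e → f e ≈ g e) → sumVec m n f ≈ sumVec m n g
  sumVec-cong m zero    f≈g = f≈g []
  sumVec-cong m (suc n) f≈g =
    trans (sumFin≈∑ m _) (trans (∑-cong (λ j → sumVec-cong m n (λ e → f≈g (j ∷ e)))) (sym (sumFin≈∑ m _)))

  sumVec-*ʳ : ∀ m n (f : Vec (Fin m) n → Carrier) x → sumVec m n f * x ≈ sumVec m n (λ e → f e * x)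
  sumVec-*ʳ m zero    f x = refl
  sumVec-*ʳ m (suc n) f x = begin
    sumFin m (λ j → sumVec m n (λ e → f (j ∷ e))) * x      ≈⟨ *-congʳ (sumFin≈∑ m _) ⟩
    (∑[ j < m ] sumVec m n (λ e → f (j ∷ e))) * x           ≈⟨ *-distribʳ-∑ x ⟩
    ∑[ j < m ] sumVec m n (λ e → f (j ∷ e)) * x             ≈⟨ ∑-cong (λ j → sumVec-*ʳ m n (λ e → f (j ∷ e)) x) ⟩
    ∑[ j < m ] sumVec m n (λ e → f (j ∷ e) * x)             ≈⟨ sumFin≈∑ m _ ⟨
    sumFin m (λ j → sumVec m n (λ e → f (j ∷ e) * x))      ∎

  slice : ∀ {m n} → Polynomial m (suc n) → Fin m → Polynomial m n
  slice P j e = P (j ∷ e)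

  eval-∷ : ∀ {m n} (P : Polynomial m (suc n)) x y →
           eval P (x ∷ y) ≈ eval₁ (λ j → eval (slice P j) y) (fromℕ (toℕ x))
  eval-∷ {m} {n} P x y =
    trans (sumFin≈∑ m _) (∑-cong (λ j → trans (sumVec-cong m n (swap j)) (sym (sumVec-*ʳ m n _ _))))
    where
    swap : ∀ j e → P (j ∷ e) * (pow (fromℕ (toℕ x)) (toℕ j) * monomial e y)
                     ≈ (P (j ∷ e) * monomial e y) * pow (fromℕ (toℕ x)) (toℕ j)
    swap j e = solve 3 (λ p u v → p :* (u :* v) := (p :* v) :* u) refl _ _ _

  slices-alternating : ∀ {M n s} {P : Polynomial (suc M) (suc n)} → ParityAlternating s P →
                       ∀ y → Alternating M (s ℕ.+ weight y) (eval₁ (λ j → eval (slice P j) y))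
  slices-alternating {s = s} {P} alt y {a} a≤M =
    ≡.subst (λ b → 0# ≤ sign (b ℕ.+ (s ℕ.+ weight y)) * eval₁ (λ j → eval (slice P j) y) (fromℕ b))
            (Fin.toℕ-fromℕ< (s≤s a≤M)) (at (Fin.fromℕ< (s≤s a≤M)))
    where
    at : ∀ x → 0# ≤ sign (toℕ x ℕ.+ (s ℕ.+ weight y)) * eval₁ (λ j → eval (slice P j) y) (fromℕ (toℕ x))
    at x = ≤-respʳ-≈ (*-cong (reflexive (≡.cong sign (ℕ+.x∙yz≈y∙xz s (toℕ x) (weight y)))) (eval-∷ P x y))
                     (alt (x ∷ y))

  positive-exponents≉0 : ∀ {M n} s (P : Polynomial (suc M) n) → ParityAlternating s P →
                         (∃ λ a → eval P a ≉ 0#) → ∀ (f : Fin n → Fin M) → P (Vec.tabulate (Fin.suc ∘ f)) ≉ 0#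
  positive-exponents≉0 {n = zero}  s P _   ([] , P[]≉0) f = ≉0-resp-≈ (*-identityʳ _) P[]≉0
  positive-exponents≉0 {n = suc n} s P alt (x₀ ∷ y₀ , Px₀y₀≉0) f =
    positive-exponents≉0 (suc (toℕ k) ℕ.+ s) (slice P (Fin.suc k)) slice-alt (y₀ , slice≉0) (f ∘ Fin.suc)
    where
    k : Fin _
    k = f Fin.zero
    coeffs : Vec (Fin (suc _)) n → Fin (suc _) → Carrier
    coeffs y j = eval (slice P j) y
    coeffs-alt : ∀ y → Alternating _ (s ℕ.+ weight y) (eval₁ (coeffs y))
    coeffs-alt = slices-alternating {s = s} {P} alt
    slice-alt : ParityAlternating (suc (toℕ k) ℕ.+ s) (slice P (Fin.suc k))
    slice-alt y = ≡.subst (λ i → 0# ≤ sign i * eval (slice P (Fin.suc k)) y)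
                          (≡.sym (ℕ.+-assoc (suc (toℕ k)) s (weight y)))
                          (eval₁-coeff-sign (coeffs y) (coeffs-alt y) (Fin.suc k))
    slice≉0 : eval (slice P (Fin.suc k)) y₀ ≉ 0#
    slice≉0 = eval₁-coeff≉0 (coeffs y₀) (coeffs-alt y₀) (Fin.toℕ≤pred[n] x₀)
                            (≉0-resp-≈ (eval-∷ P x₀ y₀) Px₀y₀≉0) k

funToFin-cong : ∀ {m n} {f g : Fin m → Fin n} → f ≗ g → Fin.funToFin f ≡ Fin.funToFin g
funToFin-cong {zero}  _   = ≡.refl
funToFin-cong {suc m} f≗g = ≡.cong₂ Fin.combine (f≗g Fin.zero) (funToFin-cong (f≗g ∘ Fin.suc))

tabulate-injective : ∀ {a} {A : Set a} {n} {f g : Fin n → A} → Vec.tabulate f ≡ Vec.tabulate g → f ≗ g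
tabulate-injective {f = f} {g} eq i =
  ≡.trans (≡.sym (Vec.lookup∘tabulate f i)) (≡.trans (≡.cong (λ v → Vec.lookup v i) eq) (Vec.lookup∘tabulate g i))

positiveDigits : ∀ {m n} → Fin (m ^ n) → Vec (Fin (suc m)) n
positiveDigits i = Vec.tabulate (Fin.suc ∘ Fin.finToFun i)

positiveDigits-injective : ∀ {m n} → Injective _≡_ _≡_ (positiveDigits {m} {n})
positiveDigits-injective {m} {n} {x = i} {y = j} eq = begin
  i                                  ≡⟨ Fin.funToFin-finToFin {n} {m} i ⟨
  Fin.funToFin {n} (Fin.finToFun i)  ≡⟨ funToFin-cong (Fin.suc-injective ∘ tabulate-injective eq) ⟩
  Fin.funToFin {n} (Fin.finToFun j)  ≡⟨ Fin.funToFin-finToFin {n} {m} j ⟩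
  j                                  ∎
  where open ≡.≡-Reasoning

open import Data.Nat using (_≤_)

theorem3p11 : ∀ {c ℓ₁ ℓ₂} (F : OrderedField c ℓ₁ ℓ₂) (m n : ℕ) → 1 ≤ m → 1 ≤ n →
  (P : Poly.Polynomial F m n) → Poly.WeaklySignRepresentsPar F P →
  ∃ λ (g : Fin ((m ∸ 1) ^ n) → Vec (Fin m) n) →
    Injective _≡_ _≡_ g × (∀ i → ¬ (OrderedField._≈_ F (P (g i)) (OrderedField.0# F)))
-- The bound also holds for n = 0.
theorem3p11 F (suc M) n (s≤s z≤n) _ P represents@(_ , nonvanishing) =
  positiveDigits , positiveDigits-injective , λ i → positive-exponents≉0 F 0 P alternating nonvanishing (Fin.finToFun i)
  where
  alternating : ParityAlternating F 0 P
  alternating = weaklySignRepresentsPar⇒parityAlternating F represents
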